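{- Let $f:\mathbb{F}_2^n\to\mathbb{F}_2$. At most one of the following holds: (1) $f$ is $\wedge$-decomposable; (2) $f$ is $\oplus$-decomposable; (3) $f$ is $\vee$-decomposable.
   Context: For a symmetric operation $\odot$ on arbitrarily many inputs, $f(x_1,\dots,x_n)$ is $\odot$-decomposable if there is a partition $\{x_1,\dots,x_n\}=\bigcup_{i=1}^t X_i$ with $t>1$, all $X_i$ nonempty and pairwise disjoint, and functions $f_i$ such that $f=\bigodot_{i=1}^t f_i(X_i)$. Here $\oplus$ is addition over $\mathbb{F}_2$. Standing assumption: $f$ depends on all of its $n$ variables. -}

module Defs where

open import Data.Nat using (ℕ; zero; suc; _≥_)
open import Data.Fin using (Fin; zero; suc)
open import Data.Bool using (Bool; true; false; not; _∧_; _∨_; _xor_)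
open import Data.Product using (Σ; ∃; _×_; _,_)
open import Function.Definitions using (Surjective)
open import Relation.Binary.PropositionalEquality using (_≡_; _≢_)

BoolFun : ℕ → Set
BoolFun n = (Fin n → Bool) → Bool

flipAt : ∀ {n} → Fin n → (Fin n → Bool) → (Fin n → Bool)
flipAt {suc n} zero    x zero    = not (x zero)
flipAt {suc n} zero    x (suc j) = x (suc j)
flipAt {suc n} (suc i) x zero    = x zero
flipAt {suc n} (suc i) x (suc j) = flipAt i (λ k → x (suc k)) j

DependsOnAll : ∀ {n} → BoolFun n → Set
DependsOnAll {n} f = (i : Fin n) → ∃ λ x → f x ≢ f (flipAt i x)

bigop : (Bool → Bool → Bool) → Bool → ∀ t → (Fin t → Bool) → Bool
bigop _⊙_ e zero    g = e
bigop _⊙_ e (suc t) g = g zero ⊙ bigop _⊙_ e t (λ i → g (suc i))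

-- f is ⊙-decomposable: there is a partition of the variables into t > 1
-- nonempty, pairwise disjoint blocks X₀,…,X_{t-1} (given by a surjective
-- block-labelling p : Fin n → Fin t, X_k = p⁻¹(k)) and functions g_k,
-- each depending only on the variables in X_k, with f = ⊙_k g_k(X_k).
Decomposable : (Bool → Bool → Bool) → Bool → ∀ {n} → BoolFun n → Set
Decomposable _⊙_ e {n} f =
  Σ ℕ λ t → t ≥ 2 × (Σ (Fin n → Fin t) λ p → Surjective _≡_ _≡_ p ×
    (Σ (Fin t → BoolFun n) λ g →
      ((k : Fin t) (x y : Fin n → Bool) →
         ((j : Fin n) → p j ≡ k → x j ≡ y j) → g k x ≡ g k y)
      × ((x : Fin n → Bool) → f x ≡ bigop _⊙_ e t (λ k → g k x))))

AndDecomposable : ∀ {n} → BoolFun n → Set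
AndDecomposable = Decomposable _∧_ true

XorDecomposable : ∀ {n} → BoolFun n → Set
XorDecomposable = Decomposable _xor_ false

OrDecomposable : ∀ {n} → BoolFun n → Set
OrDecomposable = Decomposable _∨_ false

-- Suppose f = g(X) ⊙ h(Y) with i ∈ X and j ∈ Y. On the square spanned at a
-- point z by flipping xᵢ and xⱼ, f takes the values aᵣ ⊙ bₛ (r, s ∈ {0,1}),
-- and for a commutative associative ⊙ such a table is balanced:
-- (a₀ ⊙ b₀) ⊙ (a₁ ⊙ b₁) = (a₁ ⊙ b₀) ⊙ (a₀ ⊙ b₁). Because f depends on xᵢ and
-- xⱼ, z can be chosen so that both rows and both columns differ; the table is
-- then the operation table of ⊙ with relabelled rows and columns, and that is
-- unbalanced for each of the other two operations. Two decompositions always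
-- have a pair of variables separated by both, which gives the contradiction.
module Submission where

open import Defs
open import Algebra.Core using (Op₂)
open import Algebra.Definitions using (Associative; Commutative)
open import Data.Nat using (ℕ; zero; suc; s≤s)
open import Data.Fin using (Fin; zero; suc)
open import Data.Bool using (Bool; true; false; not; _∧_; _∨_; _xor_; if_then_else_; _≟_)
open import Data.Bool.Properties
  using (∧-comm; ∨-assoc; ∨-comm; xor-assoc; xor-comm; ¬-not; not-injective; ≡-decSetoid)
open import Relation.Binary.Properties.DecSetoid ≡-decSetoid using (≉-cotrans)
open import Data.Product using (_×_; _,_; Σ; ∃; ∃₂; proj₁; proj₂)
open import Data.Sum using (inj₁; inj₂)
open import Data.Empty using (⊥)
open import Relation.Nullary using (¬_; yes; no; contradiction)
open import Relation.Binary.PropositionalEquality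
open ≡-Reasoning

nonconstant-avoids : ∀ {A : Set} {t : A → Bool} {i j : A} → t i ≢ t j → ∀ b → ∃ λ k → t k ≢ b
nonconstant-avoids {i = i} {j} t≢ b with ≉-cotrans t≢ b
... | inj₁ ti≢b = i , ti≢b
... | inj₂ b≢tj = j , ≢-sym b≢tj

commonSeparatedPair : ∀ {A : Set} (s t : A → Bool) {i₀ j₀ i₁ j₁ : A} →
                      s i₀ ≢ s j₀ → t i₁ ≢ t j₁ → ∃₂ λ i j → s i ≢ s j × t i ≢ t j
commonSeparatedPair s t {i₀} {j₀} s₀≢ t₁≢ with t i₀ ≟ t j₀
... | no t₀≢ = i₀ , j₀ , s₀≢ , t₀≢
... | yes t₀≡ with nonconstant-avoids t₁≢ (t i₀)
...   | k , tk≢ with ≉-cotrans s₀≢ (s k)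
...     | inj₁ s₀≢sk = i₀ , k , s₀≢sk , ≢-sym tk≢
...     | inj₂ sk≢s₀ = k , j₀ , sk≢s₀ , λ e → tk≢ (trans e (sym t₀≡))

flipAt-cong : ∀ {n} (i k : Fin n) {x y : Fin n → Bool} → x k ≡ y k → flipAt i x k ≡ flipAt i y k
flipAt-cong {suc n} zero    zero    e = cong not e
flipAt-cong {suc n} zero    (suc k) e = e
flipAt-cong {suc n} (suc i) zero    e = e
flipAt-cong {suc n} (suc i) (suc k) e = flipAt-cong i k e

flipAt-≢ : ∀ {n} {i k : Fin n} (x : Fin n → Bool) → k ≢ i → flipAt i x k ≡ x k
flipAt-≢ {suc n} {zero}  {zero}  x k≢i = contradiction refl k≢i
flipAt-≢ {suc n} {zero}  {suc k} x k≢i = refl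
flipAt-≢ {suc n} {suc i} {zero}  x k≢i = refl
flipAt-≢ {suc n} {suc i} {suc k} x k≢i = flipAt-≢ (λ m → x (suc m)) (λ k≡i → k≢i (cong suc k≡i))

flipIf : ∀ {n} → Bool → Fin n → (Fin n → Bool) → Fin n → Bool
flipIf false i x = x
flipIf true  i x = flipAt i x

flipIf-cong : ∀ {n} r (i k : Fin n) {x y : Fin n → Bool} → x k ≡ y k → flipIf r i x k ≡ flipIf r i y k
flipIf-cong false i k e = e
flipIf-cong true  i k e = flipAt-cong i k e

flipIf-≢ : ∀ {n} r {i k : Fin n} (x : Fin n → Bool) → k ≢ i → flipIf r i x k ≡ x k
flipIf-≢ false x k≢i = refl
flipIf-≢ true  x k≢i = flipAt-≢ x k≢i

flipIf-sensitive : ∀ {n} (g : BoolFun n) {i : Fin n} {x : Fin n → Bool} →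
                   g (flipAt i x) ≢ g x → ∀ r → g (flipIf r i x) ≡ r xor g x
flipIf-sensitive g ne false = refl
flipIf-sensitive g ne true  = ¬-not ne

DependsOnlyOn : ∀ {n} → (Fin n → Set) → BoolFun n → Set
DependsOnlyOn {n} P g = ∀ (x y : Fin n → Bool) → (∀ k → P k → x k ≡ y k) → g x ≡ g y

module _ {n} {P : Fin n → Set} {g : BoolFun n} (g-local : DependsOnlyOn P g) where

  local-flipIf-cong : ∀ {x y} → (∀ k → P k → x k ≡ y k) → ∀ r i → g (flipIf r i x) ≡ g (flipIf r i y)
  local-flipIf-cong agree r i = g-local _ _ (λ k Pk → flipIf-cong r i k (agree k Pk))

  local-flipIf-outside : ∀ {i} → (∀ k → P k → k ≢ i) → ∀ r x → g (flipIf r i x) ≡ g x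
  local-flipIf-outside outside r x = g-local _ _ (λ k Pk → flipIf-≢ r x (outside k Pk))

record Split (_⊙_ : Op₂ Bool) {n} (f : BoolFun n) : Set where
  field
    block       : Fin n → Bool
    left right  : BoolFun n
    left-local  : DependsOnlyOn (λ k → block k ≡ true) left
    right-local : DependsOnlyOn (λ k → block k ≡ false) right
    nonconstant : ∃₂ λ k l → block k ≢ block l
    decomposes  : ∀ x → f x ≡ left x ⊙ right x

  separated : ∀ {k l} → block k ≡ true → block l ≡ false → k ≢ l
  separated bk bl refl = contradiction (trans (sym bk) bl) λ ()

bigop-cong : ∀ (_⊙_ : Op₂ Bool) e t {g h : Fin t → Bool} → (∀ k → g k ≡ h k) →
             bigop _⊙_ e t g ≡ bigop _⊙_ e t h
bigop-cong _⊙_ e zero    g≗h = refl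
bigop-cong _⊙_ e (suc t) g≗h = cong₂ _⊙_ (g≗h zero) (bigop-cong _⊙_ e t (λ k → g≗h (suc k)))

isZero : ∀ {t} → Fin t → Bool
isZero zero    = true
isZero (suc _) = false

decomposable⇒split : ∀ {_⊙_ : Op₂ Bool} {e n} {f : BoolFun n} → Decomposable _⊙_ e f → Split _⊙_ f
decomposable⇒split {_⊙_} {e} {n} (suc (suc t) , s≤s (s≤s _) , p , p-surj , g , g-local , f≡) = record
  { block       = λ k → isZero (p k)
  ; left        = g zero
  ; right       = λ x → bigop _⊙_ e (suc t) (λ k → g (suc k) x)
  ; left-local  = λ x y agree → g-local zero x y (λ k pk → agree k (cong isZero pk))
  ; right-local = λ x y agree → bigop-cong _⊙_ e (suc t)
                    (λ m → g-local (suc m) x y (λ k pk → agree k (cong isZero pk)))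
  ; nonconstant = k₀ , k₁ , λ eq → contradiction (trans (sym k₀∈X₀) (trans eq k₁∉X₀)) λ ()
  ; decomposes  = f≡
  }
  where
  k₀ k₁ : Fin n
  k₀ = proj₁ (p-surj zero)
  k₁ = proj₁ (p-surj (suc zero))
  k₀∈X₀ : isZero (p k₀) ≡ true
  k₀∈X₀ = cong isZero (proj₂ (p-surj zero) refl)
  k₁∉X₀ : isZero (p k₁) ≡ false
  k₁∉X₀ = cong isZero (proj₂ (p-surj (suc zero)) refl)

swap : ∀ {_⊙_ : Op₂ Bool} {n} {f : BoolFun n} → Commutative _≡_ _⊙_ → Split _⊙_ f → Split _⊙_ f
swap comm S = record
  { block       = λ k → not (block k)
  ; left        = right
  ; right       = left
  ; left-local  = λ x y agree → right-local x y (λ k bk → agree k (cong not bk))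
  ; right-local = λ x y agree → left-local x y (λ k bk → agree k (cong not bk))
  ; nonconstant = let (k , l , bk≢bl) = nonconstant in k , l , λ e → bk≢bl (not-injective e)
  ; decomposes  = λ x → trans (decomposes x) (comm (left x) (right x))
  }
  where open Split S

orient : ∀ {_⊙_ : Op₂ Bool} {n} {f : BoolFun n} → Commutative _≡_ _⊙_ → (S : Split _⊙_ f) →
         ∀ {i j} → Split.block S i ≢ Split.block S j →
         Σ (Split _⊙_ f) λ S′ → Split.block S′ i ≡ true × Split.block S′ j ≡ false
orient comm S {i} {j} bi≢bj with Split.block S i in bi | Split.block S j in bj
... | true  | false = S , bi , bj
... | false | true  = swap comm S , cong not bi , cong not bj
... | true  | true  = contradiction refl bi≢bj
... | false | false = contradiction refl bi≢bj

Balanced : ∀ {A : Set} → Op₂ A → (Bool → Bool → A) → Set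
Balanced _⊛_ w = w false false ⊛ w true true ≡ w true false ⊛ w false true

balanced-resp : ∀ {A : Set} (_⊛_ : Op₂ A) {w w′ : Bool → Bool → A} →
                (∀ r s → w r s ≡ w′ r s) → Balanced _⊛_ w → Balanced _⊛_ w′
balanced-resp _⊛_ w≗w′ balanced =
  trans (sym (cong₂ _⊛_ (w≗w′ false false) (w≗w′ true true)))
        (trans balanced (cong₂ _⊛_ (w≗w′ true false) (w≗w′ false true)))

product-balanced : ∀ {A : Set} {_⊛_ : Op₂ A} → Associative _≡_ _⊛_ → Commutative _≡_ _⊛_ →
                   ∀ (a b : Bool → A) → Balanced _⊛_ (λ r s → a r ⊛ b s)
product-balanced {A} {_⊛_} assoc comm a b = begin
  (a₀ ⊛ b₀) ⊛ (a₁ ⊛ b₁)  ≡⟨ cong (_⊛ (a₁ ⊛ b₁)) (comm a₀ b₀) ⟩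
  (b₀ ⊛ a₀) ⊛ (a₁ ⊛ b₁)  ≡⟨ assoc b₀ a₀ (a₁ ⊛ b₁) ⟩
  b₀ ⊛ (a₀ ⊛ (a₁ ⊛ b₁))  ≡⟨ cong (b₀ ⊛_) (sym (assoc a₀ a₁ b₁)) ⟩
  b₀ ⊛ ((a₀ ⊛ a₁) ⊛ b₁)  ≡⟨ cong (λ u → b₀ ⊛ (u ⊛ b₁)) (comm a₀ a₁) ⟩
  b₀ ⊛ ((a₁ ⊛ a₀) ⊛ b₁)  ≡⟨ cong (b₀ ⊛_) (assoc a₁ a₀ b₁) ⟩
  b₀ ⊛ (a₁ ⊛ (a₀ ⊛ b₁))  ≡⟨ sym (assoc b₀ a₁ (a₀ ⊛ b₁)) ⟩
  (b₀ ⊛ a₁) ⊛ (a₀ ⊛ b₁)  ≡⟨ cong (_⊛ (a₀ ⊛ b₁)) (comm b₀ a₁) ⟩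
  (a₁ ⊛ b₀) ⊛ (a₀ ⊛ b₁)  ∎
  where
  a₀ a₁ b₀ b₁ : A
  a₀ = a false; a₁ = a true; b₀ = b false; b₁ = b true

opTable : Op₂ Bool → Bool → Bool → Bool → Bool → Bool
opTable _⊙_ c d r s = (r xor c) ⊙ (s xor d)

∧-table-xor-unbalanced : ∀ c d → ¬ Balanced _xor_ (opTable _∧_ c d)
∧-table-xor-unbalanced true  true  ()
∧-table-xor-unbalanced true  false ()
∧-table-xor-unbalanced false true  ()
∧-table-xor-unbalanced false false ()

∧-table-∨-unbalanced : ∀ c d → ¬ Balanced _∨_ (opTable _∧_ c d)
∧-table-∨-unbalanced true  true  ()
∧-table-∨-unbalanced true  false ()
∧-table-∨-unbalanced false true  ()
∧-table-∨-unbalanced false false ()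

∨-table-xor-unbalanced : ∀ c d → ¬ Balanced _xor_ (opTable _∨_ c d)
∨-table-xor-unbalanced true  true  ()
∨-table-xor-unbalanced true  false ()
∨-table-xor-unbalanced false true  ()
∨-table-xor-unbalanced false false ()

square : ∀ {n} → BoolFun n → Fin n → Fin n → (Fin n → Bool) → Bool → Bool → Bool
square f i j z r s = f (flipIf r i (flipIf s j z))

module _ {_⊙_ : Op₂ Bool} {n} {f : BoolFun n} (S : Split _⊙_ f)
         {i j : Fin n} (i-left : Split.block S i ≡ true) (j-right : Split.block S j ≡ false) where
  open Split S

  square-product : ∀ z r s → square f i j z r s ≡ left (flipIf r i z) ⊙ right (flipIf s j z)
  square-product z r s = trans (decomposes _) (cong₂ _⊙_
    (local-flipIf-cong left-local (λ k bk → flipIf-≢ s z (separated bk j-right)) r i)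
    (local-flipIf-outside right-local (λ k bk k≡i → separated i-left bk (sym k≡i)) r _))

  square-balanced : Associative _≡_ _⊙_ → Commutative _≡_ _⊙_ → ∀ z → Balanced _⊙_ (square f i j z)
  square-balanced assoc comm z = balanced-resp _⊙_ (λ r s → sym (square-product z r s))
    (product-balanced assoc comm (λ r → left (flipIf r i z)) (λ s → right (flipIf s j z)))

  left-sensitive : ∀ {x} → f (flipAt i x) ≢ f x → left (flipAt i x) ≢ left x
  left-sensitive {x} f≢ e = f≢ (begin
    f (flipAt i x)             ≡⟨ square-product x true false ⟩
    left (flipAt i x) ⊙ right x ≡⟨ cong (_⊙ right x) e ⟩
    left x ⊙ right x           ≡⟨ sym (square-product x false false) ⟩
    f x                        ∎)

  right-sensitive : ∀ {y} → f (flipAt j y) ≢ f y → right (flipAt j y) ≢ right y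
  right-sensitive {y} f≢ e = f≢ (begin
    f (flipAt j y)              ≡⟨ square-product y false true ⟩
    left y ⊙ right (flipAt j y) ≡⟨ cong (left y ⊙_) e ⟩
    left y ⊙ right y            ≡⟨ sym (square-product y false false) ⟩
    f y                         ∎)

  -- z agrees with a witness for xᵢ on the left block and with one for xⱼ on the right block.
  square-table : DependsOnAll f → ∃₂ λ z c → ∃ λ d → ∀ r s → square f i j z r s ≡ opTable _⊙_ c d r s
  square-table dependsOnAll = z , left x , right y , λ r s → begin
    square f i j z r s                          ≡⟨ square-product z r s ⟩
    left (flipIf r i z) ⊙ right (flipIf s j z)  ≡⟨ cong₂ _⊙_
                                                     (local-flipIf-cong left-local z≈x r i)
                                                     (local-flipIf-cong right-local z≈y s j) ⟩
    left (flipIf r i x) ⊙ right (flipIf s j y)  ≡⟨ cong₂ _⊙_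
                                                     (flipIf-sensitive left (left-sensitive fx≢) r)
                                                     (flipIf-sensitive right (right-sensitive fy≢) s) ⟩
    opTable _⊙_ (left x) (right y) r s          ∎
    where
    x y : Fin n → Bool
    x = proj₁ (dependsOnAll i)
    y = proj₁ (dependsOnAll j)
    fx≢ : f (flipAt i x) ≢ f x
    fx≢ = ≢-sym (proj₂ (dependsOnAll i))
    fy≢ : f (flipAt j y) ≢ f y
    fy≢ = ≢-sym (proj₂ (dependsOnAll j))
    z : Fin n → Bool
    z k = if block k then x k else y k
    z≈x : ∀ k → block k ≡ true → z k ≡ x k
    z≈x k bk rewrite bk = refl
    z≈y : ∀ k → block k ≡ false → z k ≡ y k
    z≈y k bk rewrite bk = refl

splits-incompatible : ∀ {_⊙_ _⊛_ : Op₂ Bool} → Commutative _≡_ _⊙_ →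
                      Associative _≡_ _⊛_ → Commutative _≡_ _⊛_ →
                      (∀ c d → ¬ Balanced _⊛_ (opTable _⊙_ c d)) →
                      ∀ {n} {f : BoolFun n} → DependsOnAll f → Split _⊙_ f → Split _⊛_ f → ⊥
splits-incompatible {_⊛_ = _⊛_} ⊙-comm ⊛-assoc ⊛-comm unbalanced dependsOnAll S T =
  let (_ , _ , S-nonconstant) = Split.nonconstant S
      (_ , _ , T-nonconstant) = Split.nonconstant T
      (i , j , Si≢Sj , Ti≢Tj) = commonSeparatedPair (Split.block S) (Split.block T) S-nonconstant T-nonconstant
      (S′ , i-leftS , j-rightS) = orient ⊙-comm S Si≢Sj
      (T′ , i-leftT , j-rightT) = orient ⊛-comm T Ti≢Tj
      (z , c , d , square≗table) = square-table S′ i-leftS j-rightS dependsOnAll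
  in unbalanced c d (balanced-resp _⊛_ square≗table (square-balanced T′ i-leftT j-rightT ⊛-assoc ⊛-comm z))

mainTheorem12 : (n : ℕ) (f : BoolFun n) → DependsOnAll f →
                  ¬ (AndDecomposable f × XorDecomposable f)
                  × ¬ (AndDecomposable f × OrDecomposable f)
                  × ¬ (XorDecomposable f × OrDecomposable f)
mainTheorem12 n f dependsOnAll =
    (λ (∧-dec , xor-dec) → splits-incompatible ∧-comm xor-assoc xor-comm ∧-table-xor-unbalanced
                             dependsOnAll (decomposable⇒split ∧-dec) (decomposable⇒split xor-dec))
  , (λ (∧-dec , ∨-dec) → splits-incompatible ∧-comm ∨-assoc ∨-comm ∧-table-∨-unbalanced
                             dependsOnAll (decomposable⇒split ∧-dec) (decomposable⇒split ∨-dec))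
  , (λ (xor-dec , ∨-dec) → splits-incompatible ∨-comm xor-assoc xor-comm ∨-table-xor-unbalanced
                             dependsOnAll (decomposable⇒split ∨-dec) (decomposable⇒split xor-dec))
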